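{- Let $n\ge1$ and let $S$ be a binary sequence of length $n-1$. Then the Steinhaus graph $G(S)$ is even (every vertex has even degree) if and only if the Steinhaus triangle $\theta(G(S))=\nabla\!\left(\int_{n,0} ir(S)\right)$ of size $2n-1$ is dihedrally symmetric, i.e. it is fixed by both the rotation $r$ and the reflection $h$.
   Context: A binary Steinhaus triangle of size $N\ge0$ is an array $(a_{i,j})_{1\le i\le j\le N}$ of elements of $\{0,1\}$ with $a_{i,j}\equiv a_{i-1,j-1}+a_{i-1,j}\pmod 2$ for all $2\le i\le j\le N$. It is determined by its first row, and $\nabla S$ denotes the Steinhaus triangle whose first row is the binary sequence $S$. On Steinhaus triangles of size $N$, the rotation is $r((a_{i,j}))=(a_{j-i+1,N-i+1})_{1\le i\le j\le N}$ and the horizontal reflection is $h((a_{i,j}))=(a_{i,N-j+i})_{1\le i\le j\le N}$. A Steinhaus triangle is dihedrally symmetric if $r(\nabla)=h(\nabla)=\nabla$. For a binary sequence $S=(s_1,\dots,s_{n-1})$, the Steinhaus graph $G(S)$ is the simple graph on vertices $v_1,\dots,v_n$ whose adjacency matrix $(a_{i,j})_{1\le i,j\le n}$ is symmetric with zero diagonal, has $a_{1,j}=s_{j-1}$ for $2\le j\le n$, and satisfies $a_{i,j}\equiv a_{i-1,j-1}+a_{i-1,j}\pmod 2$ for $2\le i<j\le n$. For a binary sequence $T=(t_1,\dots,t_m)$, $ir(T)=(b_j)_{1\le j\le 2m}$ is defined by $b_{2j-1}=t_j$ and $b_{2j}=t_{m-j+1}$ for $1\le j\le m$. For a binary sequence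 $T=(t_1,\dots,t_m)$, an index $i\in\{1,\dots,m+1\}$ and $x\in\{0,1\}$, the antiderived sequence $\int_{i,x}T=(c_j)_{1\le j\le m+1}$ is given by $c_j\equiv x+\sum_{k=1}^{i-1}t_k+\sum_{k=1}^{j-1}t_k\pmod 2$. -}

module Defs where

open import Data.Bool using (Bool; true; false; _xor_; if_then_else_)
open import Data.Nat using (ℕ; zero; suc; _+_; _*_; _∸_; _≤_; _≡ᵇ_; _<ᵇ_; _/_; _%_)
open import Data.Nat.Divisibility using (_∣_)
open import Data.Vec using (Vec; []; _∷_)
open import Data.Product using (_×_)
open import Relation.Binary.PropositionalEquality using (_≡_)

-- A binary sequence, indexed from 1 (values outside its range are irrelevant).
Seq : Set
Seq = ℕ → Bool

-- 1-indexed reading of a vector: (v at k) = v_k for 1 ≤ k ≤ length.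
_at_ : ∀ {m} → Vec Bool m → ℕ → Bool
[] at _ = false
(x ∷ xs) at zero = false
(x ∷ xs) at suc zero = x
(x ∷ xs) at suc (suc k) = xs at suc k

-- Steinhaus triangles: a triangle is a map (i , j) ↦ a_{i,j}, only
-- entries with 1 ≤ i ≤ j ≤ N matter.

Triangle : Set
Triangle = ℕ → ℕ → Bool

∇ : Seq → Triangle
∇ s zero j = false
∇ s (suc zero) j = s j
∇ s (suc (suc i)) j = ∇ s (suc i) (j ∸ 1) xor ∇ s (suc i) j

rot : ℕ → Triangle → Triangle
rot N a i j = a (j ∸ i + 1) (N ∸ i + 1)

hrefl : ℕ → Triangle → Triangle
hrefl N a i j = a i (N ∸ j + i)

TriEq : ℕ → Triangle → Triangle → Set
TriEq N a b = ∀ i j → 1 ≤ i → i ≤ j → j ≤ N → a i j ≡ b i j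

DihedrallySymmetric : ℕ → Triangle → Set
DihedrallySymmetric N a = TriEq N (rot N a) a × TriEq N (hrefl N a) a

-- upper-triangular entries a_{i,j} (i < j); the diagonal is zero.
steinUp : Seq → ℕ → ℕ → Bool
steinUp s zero j = false
steinUp s (suc zero) j = s (j ∸ 1)
steinUp s (suc (suc i)) j =
  (if suc i ≡ᵇ (j ∸ 1) then false else steinUp s (suc i) (j ∸ 1))
  xor steinUp s (suc i) j

steinAdj : Seq → ℕ → ℕ → Bool
steinAdj s i j =
  if i ≡ᵇ j then false else (if i <ᵇ j then steinUp s i j else steinUp s j i)

countAdj : Seq → ℕ → ℕ → ℕ
countAdj s v zero = zero
countAdj s v (suc k) = (if steinAdj s v (suc k) then 1 else 0) + countAdj s v k

degree : ∀ {m} → Vec Bool m → ℕ → ℕ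
degree {m} S v = countAdj (S at_) v (suc m)

IsEvenSteinhausGraph : ∀ {m} → Vec Bool m → Set
IsEvenSteinhausGraph {m} S = ∀ v → 1 ≤ v → v ≤ suc m → 2 ∣ degree S v

-- ir(T) for T of length m: b_{2j-1} = t_j, b_{2j} = t_{m-j+1}.
ir : ℕ → Seq → Seq
ir m t k = if k % 2 ≡ᵇ 1 then t ((k + 1) / 2) else t (m ∸ (k / 2) + 1)

xorUpTo : Seq → ℕ → Bool
xorUpTo t zero = false
xorUpTo t (suc p) = xorUpTo t p xor t (suc p)

-- ∫_{i,x} T : c_j = x + Σ_{k<i} t_k + Σ_{k<j} t_k (mod 2)
antider : ℕ → Bool → Seq → Seq
antider i x t j = (x xor xorUpTo t (i ∸ 1)) xor xorUpTo t (j ∸ 1)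

θ : ∀ {m} → Vec Bool m → Triangle
θ {m} S = ∇ (antider (suc m) false (ir m (S at_)))

module Submission where

-- Write n = m + 1, N = 2m + 1 and T = ∇S; the adjacency matrix of G(S) is T shifted
-- by one column.  The proof has four steps.
-- 1. General facts on Steinhaus triangles: ∇c is determined by its first row; the
--    rotation of ∇c is ∇ of its right edge and its reflection is ∇ of the reversed
--    first row; rows 2, 4, 6, … of ∇c sampled every second column form again a
--    Steinhaus triangle.  Row and column sums telescope.
-- 2. The first row c is a palindrome, so Θ = ∇c is always reflection invariant, and
--    it is rotation invariant iff the edge defect E_i = Θ_{i,N} + c_i vanishes.
-- 3. By step 1 the even rows of Θ interleave T with its mirror image, so the right
--    edge of Θ is read off T: the increments of E are the degree parities d_k of
--    G(S) and the last-column defects w_k = T_{k,m} + s_{m-k+1} (1 ≤ k ≤ m).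
-- 4. All d_k, w_k vanish iff G(S) is even: the last vertex has degree Σ_k T_{k,m},
--    and conversely even degrees force the last column of T to be the reversed
--    first row (a diagonal argument with mirror sums of columns of T).

open import Defs
open import Data.Nat using (ℕ; suc; _*_; _∸_)
open import Data.Vec using (Vec)
open import Data.Bool using (Bool)
open import Function.Bundles using (_⇔_)

open import Function.Bundles using (mk⇔; Equivalence)
open import Function.Properties.Equivalence using (⇔-setoid)
open import Level using (0ℓ)
import Relation.Binary.Reasoning.Setoid as SetoidReasoning

open import Data.Nat using (zero; _+_; _/_; _%_; _≤_; _<_; z≤n; s≤s; s≤s⁻¹; _≡ᵇ_; _<ᵇ_)
open import Data.Nat.Divisibility using (_∣_; divides)
open import Data.Nat.DivMod using (m*n/n≡m; m*n%n≡0; [m+kn]%n≡m%n)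
open import Data.Nat.Properties
open import Data.Bool using (true; false; _xor_; not; if_then_else_)
open import Data.Bool.Properties using (xor-same; xor-comm; xor-assoc; xor-identityʳ; not-involutive; xor-∧-commutativeRing)
open import Data.Maybe using (Maybe; just; nothing)
open import Data.Product using (Σ; _×_; _,_; proj₁; proj₂)
open import Data.Sum using (_⊎_; inj₁; inj₂)
open import Relation.Binary.PropositionalEquality
open import Relation.Nullary using (contradiction)
open import Tactic.RingSolver.Core.AlmostCommutativeRing using (AlmostCommutativeRing; fromCommutativeRing)
open import Tactic.RingSolver using (solve-∀)

-- Booleans under xor and ∧ form a commutative ring of characteristic 2; every
-- rearrangement of an xor-sum used below is an identity of this ring.
xorRing : AlmostCommutativeRing 0ℓ 0ℓ
xorRing = fromCommutativeRing xor-∧-commutativeRing isFalse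
  where
  isFalse : ∀ x → Maybe (false ≡ x)
  isFalse false = just refl
  isFalse true  = nothing

xor≡false⇒≡ : ∀ {x y} → x xor y ≡ false → x ≡ y
xor≡false⇒≡ {false} {false} _ = refl
xor≡false⇒≡ {false} {true}  ()
xor≡false⇒≡ {true}  {false} ()
xor≡false⇒≡ {true}  {true}  _ = refl

≡⇒xor≡false : ∀ {x y} → x ≡ y → x xor y ≡ false
≡⇒xor≡false {x} refl = xor-same x

xor-cancel-middle : ∀ x y z → (x xor y) xor (y xor z) ≡ x xor z
xor-cancel-middle = solve-∀ xorRing

double : ℕ → ℕ
double zero    = zero
double (suc k) = suc (suc (double k))

double≡*2 : ∀ k → double k ≡ k * 2
double≡*2 zero    = refl
double≡*2 (suc k) = cong (λ x → suc (suc x)) (double≡*2 k)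

double≡+ : ∀ k → double k ≡ k + k
double≡+ zero    = refl
double≡+ (suc k) = cong suc (trans (cong suc (double≡+ k)) (sym (+-suc k k)))

even-or-odd : ∀ i → Σ ℕ (λ q → i ≡ double q) ⊎ Σ ℕ (λ q → i ≡ suc (double q))
even-or-odd zero = inj₁ (0 , refl)
even-or-odd (suc i) with even-or-odd i
... | inj₁ (q , i≡2q)   = inj₂ (q , cong suc i≡2q)
... | inj₂ (q , i≡2q+1) = inj₁ (suc q , cong suc i≡2q+1)

double-mono-≤ : ∀ {a b} → a ≤ b → double a ≤ double b
double-mono-≤ z≤n       = z≤n
double-mono-≤ (s≤s a≤b) = s≤s (s≤s (double-mono-≤ a≤b))

double-cancel-≤ : ∀ {a b} → double a ≤ double b → a ≤ b
double-cancel-≤ {zero}              _                 = z≤n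
double-cancel-≤ {suc a} {suc b} (s≤s (s≤s 2a≤2b)) = s≤s (double-cancel-≤ 2a≤2b)

double-cancel-< : ∀ {a b} → double a < double b → a < b
double-cancel-< {zero}  {suc b} _                 = s≤s z≤n
double-cancel-< {suc a} {suc b} (s≤s (s≤s 2a<2b)) = s≤s (double-cancel-< 2a<2b)

double-∸ : ∀ {a b} → b ≤ a → double a ∸ double b ≡ double (a ∸ b)
double-∸ {a}     {zero}  _         = refl
double-∸ {suc a} {suc b} (s≤s b≤a) = double-∸ b≤a

double-∸-self : ∀ r → double r ∸ r ≡ r
double-∸-self r = trans (cong (_∸ r) (double≡+ r)) (m+n∸m≡n r r)

≤-double : ∀ r → r ≤ double r
≤-double r = ≤-trans (m≤m+n r r) (≤-reflexive (sym (double≡+ r)))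

double-∸-suc : ∀ {a b} → b < a → double a ∸ suc (double b) ≡ suc (double (a ∸ suc b))
double-∸-suc {suc a} {zero}  _         = refl
double-∸-suc {suc a} {suc b} (s≤s b<a) = double-∸-suc b<a

∸-suc : ∀ {m j} → j < m → m ∸ j ≡ suc (m ∸ suc j)
∸-suc {suc m} {zero}  _         = refl
∸-suc {suc m} {suc j} (s≤s j<m) = ∸-suc j<m

xorUpTo-cong : ∀ {f g} L → (∀ j → 1 ≤ j → j ≤ L → f j ≡ g j) → xorUpTo f L ≡ xorUpTo g L
xorUpTo-cong zero    _   = refl
xorUpTo-cong (suc L) f≗g =
  cong₂ _xor_ (xorUpTo-cong L (λ j 1≤j j≤L → f≗g j 1≤j (m≤n⇒m≤1+n j≤L))) (f≗g (suc L) (s≤s z≤n) ≤-refl)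

xorUpTo-+ : ∀ f a L → xorUpTo f (a + L) ≡ xorUpTo f a xor xorUpTo (λ j → f (a + j)) L
xorUpTo-+ f a zero = begin
  xorUpTo f (a + 0)   ≡⟨ cong (xorUpTo f) (+-identityʳ a) ⟩
  xorUpTo f a         ≡⟨ sym (xor-identityʳ _) ⟩
  xorUpTo f a xor false ∎
  where open ≡-Reasoning
xorUpTo-+ f a (suc L) = begin
  xorUpTo f (a + suc L)                                        ≡⟨ cong (xorUpTo f) (+-suc a L) ⟩
  xorUpTo f (a + L) xor f (suc (a + L))                        ≡⟨ cong₂ _xor_ (xorUpTo-+ f a L) (cong f (sym (+-suc a L))) ⟩
  (xorUpTo f a xor xorUpTo (λ j → f (a + j)) L) xor f (a + suc L) ≡⟨ xor-assoc (xorUpTo f a) _ _ ⟩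
  xorUpTo f a xor xorUpTo (λ j → f (a + j)) (suc L)            ∎
  where open ≡-Reasoning

xorUpTo-telescope : ∀ (g : Seq) a L → xorUpTo (λ j → g (a + j ∸ 1) xor g (a + j)) L ≡ g a xor g (a + L)
xorUpTo-telescope g a zero = begin
  false               ≡⟨ sym (xor-same (g a)) ⟩
  g a xor g a         ≡⟨ cong (λ x → g a xor g x) (sym (+-identityʳ a)) ⟩
  g a xor g (a + 0)   ∎
  where open ≡-Reasoning
xorUpTo-telescope g a (suc L) = begin
  xorUpTo (λ j → g (a + j ∸ 1) xor g (a + j)) L xor (g (a + suc L ∸ 1) xor g (a + suc L))
    ≡⟨ cong₂ (λ x y → x xor (g (y ∸ 1) xor g (a + suc L))) (xorUpTo-telescope g a L) (+-suc a L) ⟩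
  (g a xor g (a + L)) xor (g (a + L) xor g (a + suc L))
    ≡⟨ xor-cancel-middle (g a) (g (a + L)) (g (a + suc L)) ⟩
  g a xor g (a + suc L) ∎
  where open ≡-Reasoning

xorUpTo-reverse : ∀ f L → xorUpTo f L ≡ xorUpTo (λ j → f (L ∸ j + 1)) L
xorUpTo-reverse f zero    = refl
xorUpTo-reverse f (suc L) = begin
  xorUpTo f L xor f (suc L)                           ≡⟨ cong₂ _xor_ (xorUpTo-reverse f L) (cong f (sym (+-comm L 1))) ⟩
  xorUpTo (λ j → f (L ∸ j + 1)) L xor f (L + 1)       ≡⟨ xor-comm _ (f (L + 1)) ⟩
  f (L + 1) xor xorUpTo (λ j → f (L ∸ j + 1)) L       ≡⟨ sym (xorUpTo-+ (λ j → f (suc L ∸ j + 1)) 1 L) ⟩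
  xorUpTo (λ j → f (suc L ∸ j + 1)) (suc L)           ∎
  where open ≡-Reasoning

IsSteinhaus : ℕ → Triangle → Set
IsSteinhaus K Q = ∀ i j → 1 ≤ i → i < j → j ≤ K → Q (suc i) j ≡ Q i (j ∸ 1) xor Q i j

∇-isSteinhaus : ∀ c K → IsSteinhaus K (∇ c)
∇-isSteinhaus c K (suc i) j _ _ _ = refl

steinhaus-unique : ∀ Q c K → IsSteinhaus K Q → (∀ j → 1 ≤ j → j ≤ K → Q 1 j ≡ c j) → TriEq K Q (∇ c)
steinhaus-unique Q c K rule row₁ (suc zero) j _ 1≤j j≤K = row₁ j 1≤j j≤K
steinhaus-unique Q c K rule row₁ (suc (suc i)) (suc j) _ 2+i≤1+j@(s≤s 1+i≤j) 1+j≤K =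
  trans (rule (suc i) (suc j) (s≤s z≤n) 2+i≤1+j 1+j≤K)
        (cong₂ _xor_ (steinhaus-unique Q c K rule row₁ (suc i) j (s≤s z≤n) 1+i≤j (≤-trans (n≤1+n j) 1+j≤K))
                     (steinhaus-unique Q c K rule row₁ (suc i) (suc j) (s≤s z≤n) (m≤n⇒m≤1+n 1+i≤j) 1+j≤K))

∇-cong : ∀ {c d} K → (∀ j → 1 ≤ j → j ≤ K → c j ≡ d j) → TriEq K (∇ c) (∇ d)
∇-cong {c} {d} K c≗d = steinhaus-unique (∇ c) d K (∇-isSteinhaus c K) c≗d

∇-upper-left : ∀ c i j → 1 ≤ i → ∇ c i j ≡ ∇ c i (suc j) xor ∇ c (suc i) (suc j)
∇-upper-left c (suc i) j _ = recover (∇ c (suc i) j) (∇ c (suc i) (suc j))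
  where
  recover : ∀ x y → x ≡ y xor (x xor y)
  recover = solve-∀ xorRing

rot-∇ : ∀ c K → TriEq K (rot K (∇ c)) (∇ (λ i → ∇ c i K))
rot-∇ c K = steinhaus-unique (rot K (∇ c)) (λ i → ∇ c i K) K rule row₁
  where
  rule : IsSteinhaus K (rot K (∇ c))
  rule i j _ i<j j≤K = begin
    ∇ c (j ∸ suc i + 1) (K ∸ suc i + 1)
      ≡⟨ cong₂ (∇ c) (+-comm (j ∸ suc i) 1) (+-comm (K ∸ suc i) 1) ⟩
    ∇ c (suc p) (suc q)
      ≡⟨ ∇-upper-left c (suc p) (suc q) (s≤s z≤n) ⟩
    ∇ c (suc p) (suc (suc q)) xor ∇ c (suc (suc p)) (suc (suc q))
      ≡⟨ sym (cong₂ _xor_ (cong₂ (∇ c) row-1 col) (cong₂ (∇ c) row col)) ⟩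
    ∇ c (j ∸ 1 ∸ i + 1) (K ∸ i + 1) xor ∇ c (j ∸ i + 1) (K ∸ i + 1) ∎
    where
    open ≡-Reasoning
    p q : ℕ
    p = j ∸ suc i
    q = K ∸ suc i
    row-1 : j ∸ 1 ∸ i + 1 ≡ suc p
    row-1 = trans (+-comm _ 1) (cong suc (∸-+-assoc j 1 i))
    row : j ∸ i + 1 ≡ suc (suc p)
    row = trans (+-comm _ 1) (cong suc (∸-suc i<j))
    col : K ∸ i + 1 ≡ suc (suc q)
    col = trans (+-comm _ 1) (cong suc (∸-suc (≤-trans i<j j≤K)))
  row₁ : ∀ j → 1 ≤ j → j ≤ K → rot K (∇ c) 1 j ≡ ∇ c j K
  row₁ j 1≤j j≤K = cong₂ (∇ c) (m∸n+n≡m 1≤j) (m∸n+n≡m (≤-trans 1≤j j≤K))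

hrefl-∇ : ∀ c K → TriEq K (hrefl K (∇ c)) (∇ (λ j → c (K ∸ j + 1)))
hrefl-∇ c K = steinhaus-unique (hrefl K (∇ c)) (λ j → c (K ∸ j + 1)) K rule (λ _ _ _ → refl)
  where
  rule : IsSteinhaus K (hrefl K (∇ c))
  rule (suc i) (suc j) _ _ 1+j≤K = begin
    ∇ c (suc i) (K ∸ suc j + suc (suc i) ∸ 1) xor ∇ c (suc i) (K ∸ suc j + suc (suc i))
      ≡⟨ cong₂ _xor_ (cong (∇ c (suc i)) left) (cong (∇ c (suc i)) right) ⟩
    ∇ c (suc i) (K ∸ suc j + suc i) xor ∇ c (suc i) (K ∸ j + suc i)
      ≡⟨ xor-comm (∇ c (suc i) (K ∸ suc j + suc i)) (∇ c (suc i) (K ∸ j + suc i)) ⟩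
    ∇ c (suc i) (K ∸ j + suc i) xor ∇ c (suc i) (K ∸ suc j + suc i) ∎
    where
    open ≡-Reasoning
    left : K ∸ suc j + suc (suc i) ∸ 1 ≡ K ∸ suc j + suc i
    left = cong (_∸ 1) (+-suc (K ∸ suc j) (suc i))
    right : K ∸ suc j + suc (suc i) ≡ K ∸ j + suc i
    right = trans (+-suc (K ∸ suc j) (suc i)) (cong (_+ suc i) (sym (∸-suc 1+j≤K)))

edge⇔rot-invariant : ∀ c K → (∀ i → 1 ≤ i → i ≤ K → ∇ c i K ≡ c i) ⇔ TriEq K (rot K (∇ c)) (∇ c)
edge⇔rot-invariant c K = mk⇔
  (λ edge i j 1≤i i≤j j≤K → trans (rot-∇ c K i j 1≤i i≤j j≤K) (∇-cong K edge i j 1≤i i≤j j≤K))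
  (λ invariant i 1≤i i≤K → trans (sym (rot-∇ c K 1 i ≤-refl 1≤i i≤K)) (invariant 1 i ≤-refl 1≤i i≤K))

hrefl-invariant : ∀ c K → (∀ j → 1 ≤ j → j ≤ K → c (K ∸ j + 1) ≡ c j) → TriEq K (hrefl K (∇ c)) (∇ c)
hrefl-invariant c K palindrome i j 1≤i i≤j j≤K =
  trans (hrefl-∇ c K i j 1≤i i≤j j≤K) (∇-cong K palindrome i j 1≤i i≤j j≤K)

-- Adding to each entry of column j+1 of ∇c its mirror image in that column gives
-- again a Steinhaus triangle, whose first row is  g j = a_{1,j+1} + a_{j,j+1}
-- and whose diagonal is g as well.
∇-diagonal-of-mirror-sums : ∀ c k → 1 ≤ k →
  ∇ (λ j → ∇ c 1 (suc j) xor ∇ c j (suc j)) k k ≡ ∇ c 1 (suc k) xor ∇ c k (suc k)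
∇-diagonal-of-mirror-sums c k 1≤k = begin
  ∇ g k k  ≡⟨ sym (steinhaus-unique Q g k rule row₁ k k 1≤k ≤-refl ≤-refl) ⟩
  Q k k    ≡⟨ cong (λ r → ∇ c k (suc k) xor ∇ c (r + 1) (suc k)) (n∸n≡0 k) ⟩
  ∇ c k (suc k) xor ∇ c 1 (suc k) ≡⟨ xor-comm (∇ c k (suc k)) (∇ c 1 (suc k)) ⟩
  g k      ∎
  where
  open ≡-Reasoning
  g : Seq
  g j = ∇ c 1 (suc j) xor ∇ c j (suc j)
  Q : Triangle
  Q i j = ∇ c i (suc j) xor ∇ c (j ∸ i + 1) (suc j)
  rearrange : ∀ a b x y → (a xor b) xor y ≡ (a xor x) xor (b xor (x xor y))
  rearrange = solve-∀ xorRing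
  rule : IsSteinhaus k Q
  rule (suc i) (suc j) _ (s≤s i<j) _ = begin
    (a xor b) xor ∇ c (j ∸ suc i + 1) (suc (suc j))
      ≡⟨ cong (λ r → (a xor b) xor ∇ c r (suc (suc j))) (+-comm p 1) ⟩
    (a xor b) xor ∇ c (suc p) (suc (suc j))
      ≡⟨ rearrange a b (∇ c (suc p) (suc j)) (∇ c (suc p) (suc (suc j))) ⟩
    (a xor ∇ c (suc p) (suc j)) xor (b xor ∇ c (suc (suc p)) (suc (suc j)))
      ≡⟨ sym (cong₂ (λ r r′ → (a xor ∇ c r (suc j)) xor (b xor ∇ c r′ (suc (suc j))))
                    (+-comm p 1) (trans (+-comm _ 1) (cong suc (∸-suc i<j)))) ⟩
    (a xor ∇ c (j ∸ suc i + 1) (suc j)) xor (b xor ∇ c (j ∸ i + 1) (suc (suc j))) ∎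
    where
    p : ℕ
    p = j ∸ suc i
    a b : Bool
    a = ∇ c (suc i) (suc j)
    b = ∇ c (suc i) (suc (suc j))
  row₁ : ∀ j → 1 ≤ j → j ≤ k → Q 1 j ≡ g j
  row₁ j 1≤j _ = cong (λ r → ∇ c 1 (suc j) xor ∇ c r (suc j)) (m∸n+n≡m 1≤j)

-- Two rows down: a_{i+2,j} = a_{i,j-2} + a_{i,j}, the middle parent cancelling.
∇-two-rows : ∀ c i j → ∇ c (3 + i) j ≡ ∇ c (suc i) (j ∸ 2) xor ∇ c (suc i) j
∇-two-rows c i j = trans (xor-cancel-middle (∇ c (suc i) (j ∸ 1 ∸ 1)) (∇ c (suc i) (j ∸ 1)) (∇ c (suc i) j))
                         (cong (λ r → ∇ c (suc i) r xor ∇ c (suc i) j) (∸-+-assoc j 1 1))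

∇-even-rows : ∀ c (col : ℕ → ℕ) → (∀ l → col (suc l) ∸ 2 ≡ col l) → ∀ K →
  TriEq K (λ k l → ∇ c (double k) (col l)) (∇ (λ l → ∇ c 2 (col l)))
∇-even-rows c col step K = steinhaus-unique (λ k l → ∇ c (double k) (col l)) (λ l → ∇ c 2 (col l)) K rule (λ _ _ _ → refl)
  where
  rule : IsSteinhaus K (λ k l → ∇ c (double k) (col l))
  rule (suc k) (suc l) _ _ _ =
    trans (∇-two-rows c (suc (double k)) (col (suc l)))
          (cong (λ r → ∇ c (double (suc k)) r xor ∇ c (double (suc k)) (col (suc l))) (step l))

∇-column-sum : ∀ c k → xorUpTo (λ i → ∇ c i k) k ≡ ∇ c 1 (suc k) xor ∇ c (suc k) (suc k)
∇-column-sum c k = trans (xorUpTo-cong k (λ i 1≤i _ → ∇-upper-left c i k 1≤i))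
                         (xorUpTo-telescope (λ i → ∇ c i (suc k)) 1 k)

∇-row-sum : ∀ c k L → 1 ≤ k → xorUpTo (λ j → ∇ c (suc k) (k + j)) L ≡ ∇ c k k xor ∇ c k (k + L)
∇-row-sum c (suc k) L _ = xorUpTo-telescope (∇ c (suc k)) (suc k) L

oddᵇ : ℕ → Bool
oddᵇ zero    = false
oddᵇ (suc n) = not (oddᵇ n)

2∣⇔oddᵇ≡false : ∀ n → 2 ∣ n ⇔ oddᵇ n ≡ false
2∣⇔oddᵇ≡false n = mk⇔ (λ { (divides q refl) → even-multiple q }) (even-parity⇒2∣ n)
  where
  even-multiple : ∀ q → oddᵇ (q * 2) ≡ false
  even-multiple zero    = refl
  even-multiple (suc q) = trans (not-involutive _) (even-multiple q)
  even-parity⇒2∣ : ∀ n → oddᵇ n ≡ false → 2 ∣ n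
  even-parity⇒2∣ zero          _ = divides 0 refl
  even-parity⇒2∣ (suc (suc n)) odd≡false with even-parity⇒2∣ n (trans (sym (not-involutive (oddᵇ n))) odd≡false)
  ... | divides q n≡2q = divides (suc q) (cong (λ x → suc (suc x)) n≡2q)

degreeParity : Seq → ℕ → ℕ → Bool
degreeParity s n v = xorUpTo (steinAdj s v) n

oddᵇ-countAdj : ∀ s v k → oddᵇ (countAdj s v k) ≡ degreeParity s k v
oddᵇ-countAdj s v zero = refl
oddᵇ-countAdj s v (suc k) with steinAdj s v (suc k)
... | true  = trans (cong not (oddᵇ-countAdj s v k)) (xor-comm true _)
... | false = trans (oddᵇ-countAdj s v k) (sym (xor-identityʳ _))

≡ᵇ-< : ∀ {a b} → a < b → (a ≡ᵇ b) ≡ false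
≡ᵇ-< {zero}  {suc b} _         = refl
≡ᵇ-< {suc a} {suc b} (s≤s a<b) = ≡ᵇ-< a<b

≡ᵇ-> : ∀ {a b} → b < a → (a ≡ᵇ b) ≡ false
≡ᵇ-> {suc a} {zero}  _         = refl
≡ᵇ-> {suc a} {suc b} (s≤s b<a) = ≡ᵇ-> b<a

≡ᵇ-refl : ∀ a → (a ≡ᵇ a) ≡ true
≡ᵇ-refl zero    = refl
≡ᵇ-refl (suc a) = ≡ᵇ-refl a

<ᵇ-< : ∀ {a b} → a < b → (a <ᵇ b) ≡ true
<ᵇ-< {zero}  {suc b} _         = refl
<ᵇ-< {suc a} {suc b} (s≤s a<b) = <ᵇ-< a<b

<ᵇ-> : ∀ {a b} → b < a → (a <ᵇ b) ≡ false
<ᵇ-> {suc a} {zero}  _         = refl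
<ᵇ-> {suc a} {suc b} (s≤s b<a) = <ᵇ-> b<a

steinUp≡∇ : ∀ s i j → 1 ≤ i → i < j → steinUp s i j ≡ ∇ s i (j ∸ 1)
steinUp≡∇ s (suc zero)    j       _ _ = refl
steinUp≡∇ s (suc (suc i)) (suc j) _ (s≤s 1+i<j) =
  cong₂ _xor_ (trans (cong (λ b → if b then false else steinUp s (suc i) j) (≡ᵇ-< 1+i<j))
                     (steinUp≡∇ s (suc i) j (s≤s z≤n) 1+i<j))
              (steinUp≡∇ s (suc i) (suc j) (s≤s z≤n) (m≤n⇒m≤1+n 1+i<j))

steinAdj-above : ∀ s v j → 1 ≤ v → v < j → steinAdj s v j ≡ ∇ s v (j ∸ 1)
steinAdj-above s v j 1≤v v<j rewrite ≡ᵇ-< v<j | <ᵇ-< v<j = steinUp≡∇ s v j 1≤v v<j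

steinAdj-below : ∀ s v j → 1 ≤ j → j < v → steinAdj s v j ≡ ∇ s j (v ∸ 1)
steinAdj-below s v j 1≤j j<v rewrite ≡ᵇ-> j<v | <ᵇ-> j<v = steinUp≡∇ s j v 1≤j j<v

steinAdj-diagonal : ∀ s v → steinAdj s v v ≡ false
steinAdj-diagonal s v rewrite ≡ᵇ-refl v = refl

module SteinhausGraph (m : ℕ) (s : Seq) where

  T : Triangle
  T = ∇ s

  deg : ℕ → Bool
  deg = degreeParity s (suc m)

  -- Vertex k+1 has its lower neighbours in column k of T and its upper ones in row k+1.
  deg-split : ∀ k → k ≤ m → deg (suc k) ≡ xorUpTo (λ i → T i k) k xor xorUpTo (λ j → T (suc k) (k + j)) (m ∸ k)
  deg-split k k≤m = begin
    xorUpTo adj (suc m)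
      ≡⟨ cong (xorUpTo adj) (sym (m+[n∸m]≡n (s≤s k≤m))) ⟩
    xorUpTo adj (suc k + (m ∸ k))
      ≡⟨ xorUpTo-+ adj (suc k) (m ∸ k) ⟩
    (xorUpTo adj k xor adj (suc k)) xor xorUpTo (λ j → adj (suc k + j)) (m ∸ k)
      ≡⟨ cong (λ x → (xorUpTo adj k xor x) xor xorUpTo (λ j → adj (suc k + j)) (m ∸ k)) (steinAdj-diagonal s (suc k)) ⟩
    (xorUpTo adj k xor false) xor xorUpTo (λ j → adj (suc k + j)) (m ∸ k)
      ≡⟨ cong₂ _xor_ (trans (xor-identityʳ _) lower) upper ⟩
    xorUpTo (λ i → T i k) k xor xorUpTo (λ j → T (suc k) (k + j)) (m ∸ k) ∎
    where
    open ≡-Reasoning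
    adj : Seq
    adj = steinAdj s (suc k)
    lower : xorUpTo adj k ≡ xorUpTo (λ i → T i k) k
    lower = xorUpTo-cong k (λ i 1≤i i≤k → steinAdj-below s (suc k) i 1≤i (s≤s i≤k))
    upper : xorUpTo (λ j → adj (suc k + j)) (m ∸ k) ≡ xorUpTo (λ j → T (suc k) (k + j)) (m ∸ k)
    upper = xorUpTo-cong (m ∸ k) (λ j 1≤j _ → steinAdj-above s (suc k) (suc k + j) (s≤s z≤n) (m<m+n (suc k) 1≤j))

  deg-first : deg 1 ≡ xorUpTo s m
  deg-first = deg-split 0 z≤n

  deg-last : deg (suc m) ≡ xorUpTo (λ i → T i m) m
  deg-last = trans (deg-split m ≤-refl)
                   (trans (cong (λ L → xorUpTo (λ i → T i m) m xor xorUpTo (λ j → T (suc m) (m + j)) L) (n∸n≡0 m))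
                          (xor-identityʳ _))

  deg-inner : ∀ k → 1 ≤ k → k ≤ m → deg (suc k) ≡ (s (suc k) xor T (suc k) (suc k)) xor (T k k xor T k m)
  deg-inner k 1≤k k≤m =
    trans (deg-split k k≤m)
          (cong₂ _xor_ (∇-column-sum s k)
                       (trans (∇-row-sum s k (m ∸ k) 1≤k) (cong (λ j → T k k xor T k j) (m+[n∸m]≡n k≤m))))

  -- By
  -- deg-inner, even degrees say T_{k,m} = g k for the mirror sums g of
  -- ∇-diagonal-of-mirror-sums; so the triangle of column m, which is the rotation
  -- of T, has the diagonal of ∇g, namely g itself.
  even⇒last-column : (∀ v → 1 ≤ v → v ≤ suc m → deg v ≡ false) → ∀ k → 1 ≤ k → k ≤ m → T k m ≡ s (m ∸ k + 1)
  even⇒last-column even k 1≤k k≤m = begin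
    T k m                      ≡⟨ column≡g k 1≤k k≤m ⟩
    g k                        ≡⟨ sym (∇-diagonal-of-mirror-sums s k 1≤k) ⟩
    ∇ g k k                    ≡⟨ sym (∇-cong m column≡g k k 1≤k ≤-refl k≤m) ⟩
    ∇ (λ i → T i m) k k        ≡⟨ sym (rot-∇ s m k k 1≤k ≤-refl k≤m) ⟩
    T (k ∸ k + 1) (m ∸ k + 1)  ≡⟨ cong (λ r → T (r + 1) (m ∸ k + 1)) (n∸n≡0 k) ⟩
    s (m ∸ k + 1)              ∎
    where
    open ≡-Reasoning
    g : Seq
    g j = T 1 (suc j) xor T j (suc j)
    rearrange : ∀ a x y z → (a xor (x xor y)) xor (x xor z) ≡ (a xor y) xor z
    rearrange = solve-∀ xorRing
    deg≡ : ∀ j → 1 ≤ j → j ≤ m → deg (suc j) ≡ g j xor T j m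
    deg≡ (suc j) 1≤j j≤m =
      trans (deg-inner (suc j) 1≤j j≤m) (rearrange (s (suc (suc j))) (T (suc j) (suc j)) (T (suc j) (suc (suc j))) (T (suc j) m))
    column≡g : ∀ j → 1 ≤ j → j ≤ m → T j m ≡ g j
    column≡g j 1≤j j≤m = sym (xor≡false⇒≡ (trans (sym (deg≡ j 1≤j j≤m)) (even (suc j) (s≤s z≤n) (s≤s j≤m))))

  lastColumnDefect : ℕ → Bool
  lastColumnDefect k = T k m xor s (m ∸ k + 1)

  even⇔defects : (∀ v → 1 ≤ v → v ≤ suc m → deg v ≡ false)
               ⇔ (∀ k → k < m → deg (suc k) ≡ false × lastColumnDefect (suc k) ≡ false)
  even⇔defects = mk⇔ even⇒defects defects⇒even
    where
    open ≡-Reasoning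
    defects⇒even : (∀ k → k < m → deg (suc k) ≡ false × lastColumnDefect (suc k) ≡ false) → ∀ v → 1 ≤ v → v ≤ suc m → deg v ≡ false
    defects⇒even defects (suc k) _ (s≤s k≤m) with m≤n⇒m<n∨m≡n k≤m
    ... | inj₁ k<m  = proj₁ (defects k k<m)
    ... | inj₂ refl = begin
      deg (suc m)                          ≡⟨ deg-last ⟩
      xorUpTo (λ i → T i m) m              ≡⟨ xorUpTo-cong m reversed ⟩
      xorUpTo (λ i → s (m ∸ i + 1)) m      ≡⟨ sym (xorUpTo-reverse s m) ⟩
      xorUpTo s m                          ≡⟨ sym deg-first ⟩
      deg 1                                ≡⟨ first ⟩
      false                                ∎
      where
      reversed : ∀ i → 1 ≤ i → i ≤ m → T i m ≡ s (m ∸ i + 1)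
      reversed (suc i) _ 1+i≤m = xor≡false⇒≡ (proj₂ (defects i 1+i≤m))
      first : deg 1 ≡ false
      first with m≤n⇒m<n∨m≡n (z≤n {m})
      ... | inj₁ 0<m  = proj₁ (defects 0 0<m)
      ... | inj₂ 0≡m = trans deg-first (cong (xorUpTo s) (sym 0≡m))
    even⇒defects : (∀ v → 1 ≤ v → v ≤ suc m → deg v ≡ false) → ∀ k → k < m → deg (suc k) ≡ false × lastColumnDefect (suc k) ≡ false
    even⇒defects even k k<m = even (suc k) (s≤s z≤n) (m≤n⇒m≤1+n k<m)
                    , ≡⇒xor≡false (even⇒last-column even (suc k) (s≤s z≤n) k<m)

step-vanishes : ∀ {a b x} → a ≡ b xor x → a ≡ false → b ≡ false → x ≡ false
step-vanishes a≡b+x a≡0 refl = trans (sym a≡b+x) a≡0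

alternating-increments : ∀ (E x y : Seq) m → E 1 ≡ false →
  (∀ k → k < m → E (double (suc k)) ≡ E (suc (double k)) xor x (suc k)) →
  (∀ k → k < m → E (suc (double (suc k))) ≡ E (double (suc k)) xor y (suc k)) →
  (∀ k → k < m → x (suc k) ≡ false × y (suc k) ≡ false) ⇔ (∀ i → 1 ≤ i → i ≤ suc (double m) → E i ≡ false)
alternating-increments E x y m E₁≡0 even-step odd-step = mk⇔ increments⇒vanishing vanishing⇒increments
  where
  vanishing⇒increments : (∀ i → 1 ≤ i → i ≤ suc (double m) → E i ≡ false) → ∀ k → k < m → x (suc k) ≡ false × y (suc k) ≡ false
  vanishing⇒increments E≡0 k k<m = step-vanishes (even-step k k<m) E-even E-odd , step-vanishes (odd-step k k<m) E-next E-even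
    where
    E-odd : E (suc (double k)) ≡ false
    E-odd = E≡0 (suc (double k)) (s≤s z≤n) (s≤s (double-mono-≤ (<⇒≤ k<m)))
    E-even : E (double (suc k)) ≡ false
    E-even = E≡0 (double (suc k)) (s≤s z≤n) (m≤n⇒m≤1+n (double-mono-≤ k<m))
    E-next : E (suc (double (suc k))) ≡ false
    E-next = E≡0 (suc (double (suc k))) (s≤s z≤n) (s≤s (double-mono-≤ k<m))

  module _ (increments≡0 : ∀ k → k < m → x (suc k) ≡ false × y (suc k) ≡ false) where
    E-odd≡0  : ∀ k → k ≤ m → E (suc (double k)) ≡ false
    E-even≡0 : ∀ k → k < m → E (double (suc k)) ≡ false
    E-odd≡0 zero    _   = E₁≡0
    E-odd≡0 (suc k) k<m = trans (odd-step k k<m) (cong₂ _xor_ (E-even≡0 k k<m) (proj₂ (increments≡0 k k<m)))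
    E-even≡0 k k<m = trans (even-step k k<m) (cong₂ _xor_ (E-odd≡0 k (<⇒≤ k<m)) (proj₁ (increments≡0 k k<m)))

  increments⇒vanishing : (∀ k → k < m → x (suc k) ≡ false × y (suc k) ≡ false) → ∀ i → 1 ≤ i → i ≤ suc (double m) → E i ≡ false
  increments⇒vanishing increments≡0 i 1≤i i≤2m+1 with even-or-odd i
  ... | inj₁ (zero  , refl) = contradiction 1≤i λ ()
  ... | inj₁ (suc q , refl) = E-even≡0 increments≡0 q (double-cancel-< (s≤s⁻¹ i≤2m+1))
  ... | inj₂ (q     , refl) = E-odd≡0 increments≡0 q (double-cancel-≤ (s≤s⁻¹ i≤2m+1))

ir-at-odd : ∀ m t k → k % 2 ≡ 1 → ir m t k ≡ t ((k + 1) / 2)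
ir-at-odd m t k k%2≡1 rewrite k%2≡1 = refl

ir-at-even : ∀ m t k → k % 2 ≡ 0 → ir m t k ≡ t (m ∸ k / 2 + 1)
ir-at-even m t k k%2≡0 rewrite k%2≡0 = refl

ir-odd : ∀ m t j → ir m t (suc (double j)) ≡ t (suc j)
ir-odd m t j = begin
  ir m t (suc (double j))   ≡⟨ cong (λ k → ir m t (suc k)) (double≡*2 j) ⟩
  ir m t (1 + j * 2)        ≡⟨ ir-at-odd m t (1 + j * 2) ([m+kn]%n≡m%n 1 j 2) ⟩
  t ((1 + j * 2 + 1) / 2)   ≡⟨ cong (λ k → t (k / 2)) (+-comm (1 + j * 2) 1) ⟩
  t (suc j * 2 / 2)         ≡⟨ cong t (m*n/n≡m (suc j) 2) ⟩
  t (suc j)                 ∎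
  where open ≡-Reasoning

ir-even : ∀ m t j → ir m t (double (suc j)) ≡ t (m ∸ suc j + 1)
ir-even m t j = begin
  ir m t (double (suc j))       ≡⟨ cong (ir m t) (double≡*2 (suc j)) ⟩
  ir m t (suc j * 2)            ≡⟨ ir-at-even m t (suc j * 2) (m*n%n≡0 (suc j) 2) ⟩
  t (m ∸ suc j * 2 / 2 + 1)     ≡⟨ cong (λ k → t (m ∸ k + 1)) (m*n/n≡m (suc j) 2) ⟩
  t (m ∸ suc j + 1)             ∎
  where open ≡-Reasoning

module Interleaving (m : ℕ) (s : Seq) where

  b : Seq
  b = ir m s

  P : ℕ → Bool
  P = xorUpTo b

  A : ℕ → Bool
  A = xorUpTo s

  P-even : ∀ j → j ≤ m → P (double j) ≡ A j xor A m xor A (m ∸ j)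
  P-odd  : ∀ j → j < m → P (suc (double j)) ≡ A (suc j) xor A m xor A (m ∸ j)
  P-even zero    _   = sym (xor-same (A m))
  P-even (suc j) j<m = begin
    P (suc (double j)) xor b (double (suc j))
      ≡⟨ cong₂ _xor_ (P-odd j j<m) (trans (ir-even m s j) (cong s (+-comm r 1))) ⟩
    (A (suc j) xor A m xor A (m ∸ j)) xor s (suc r)
      ≡⟨ cong (λ x → (A (suc j) xor A m xor A x) xor s (suc r)) (∸-suc j<m) ⟩
    (A (suc j) xor A m xor (A r xor s (suc r))) xor s (suc r)
      ≡⟨ cancel (A (suc j)) (A m) (A r) (s (suc r)) ⟩
    A (suc j) xor A m xor A r ∎
    where
    open ≡-Reasoning
    r : ℕ
    r = m ∸ suc j
    cancel : ∀ a x y z → (a xor x xor (y xor z)) xor z ≡ a xor x xor y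
    cancel = solve-∀ xorRing
  P-odd j j<m = begin
    P (double j) xor b (suc (double j))
      ≡⟨ cong₂ _xor_ (P-even j (<⇒≤ j<m)) (ir-odd m s j) ⟩
    (A j xor A m xor A (m ∸ j)) xor s (suc j)
      ≡⟨ move (A j) (A m) (A (m ∸ j)) (s (suc j)) ⟩
    (A j xor s (suc j)) xor A m xor A (m ∸ j) ∎
    where
    open ≡-Reasoning
    move : ∀ a x y z → (a xor x xor y) xor z ≡ (a xor z) xor x xor y
    move = solve-∀ xorRing

  swap-ends : ∀ x y z → x xor y xor z ≡ z xor y xor x
  swap-ends = solve-∀ xorRing

  P-palindrome : ∀ i → i ≤ double m → P (double m ∸ i) ≡ P i
  P-palindrome i i≤2m with even-or-odd i
  ... | inj₁ (q , refl) = begin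
    P (double m ∸ double q)                 ≡⟨ cong P (double-∸ q≤m) ⟩
    P (double (m ∸ q))                      ≡⟨ P-even (m ∸ q) (m∸n≤m m q) ⟩
    A (m ∸ q) xor A m xor A (m ∸ (m ∸ q))   ≡⟨ cong (λ x → A (m ∸ q) xor A m xor A x) (m∸[m∸n]≡n q≤m) ⟩
    A (m ∸ q) xor A m xor A q               ≡⟨ swap-ends (A (m ∸ q)) (A m) (A q) ⟩
    A q xor A m xor A (m ∸ q)               ≡⟨ sym (P-even q q≤m) ⟩
    P (double q)                            ∎
    where
    open ≡-Reasoning
    q≤m : q ≤ m
    q≤m = double-cancel-≤ i≤2m
  ... | inj₂ (q , refl) = begin
    P (double m ∸ suc (double q))                         ≡⟨ cong P (double-∸-suc q<m) ⟩
    P (suc (double (m ∸ suc q)))                          ≡⟨ P-odd (m ∸ suc q) (∸-monoʳ-< (s≤s z≤n) q<m) ⟩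
    A (suc (m ∸ suc q)) xor A m xor A (m ∸ (m ∸ suc q))
      ≡⟨ cong₂ (λ x y → A x xor A m xor A y) (sym (∸-suc q<m)) (m∸[m∸n]≡n q<m) ⟩
    A (m ∸ q) xor A m xor A (suc q)                       ≡⟨ swap-ends (A (m ∸ q)) (A m) (A (suc q)) ⟩
    A (suc q) xor A m xor A (m ∸ q)                       ≡⟨ sym (P-odd q q<m) ⟩
    P (suc (double q))                                    ∎
    where
    open ≡-Reasoning
    q<m : q < m
    q<m = double-cancel-< i≤2m

  cancel-outer : ∀ x y → x xor y xor x ≡ y
  cancel-outer = solve-∀ xorRing

  -- The first half of b contains each letter of s exactly once: P_m = A_m.
  P-half : P m ≡ A m
  P-half with even-or-odd m
  ... | inj₁ (r , m≡2r) = begin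
    P m                         ≡⟨ cong P m≡2r ⟩
    P (double r)                ≡⟨ P-even r (≤-trans (≤-double r) (≤-reflexive (sym m≡2r))) ⟩
    A r xor A m xor A (m ∸ r)   ≡⟨ cong (λ x → A r xor A m xor A x) (trans (cong (_∸ r) m≡2r) (double-∸-self r)) ⟩
    A r xor A m xor A r         ≡⟨ cancel-outer (A r) (A m) ⟩
    A m                         ∎
    where open ≡-Reasoning
  ... | inj₂ (r , m≡2r+1) = begin
    P m                                 ≡⟨ cong P m≡2r+1 ⟩
    P (suc (double r))                  ≡⟨ P-odd r (≤-trans (s≤s (≤-double r)) (≤-reflexive (sym m≡2r+1))) ⟩
    A (suc r) xor A m xor A (m ∸ r)     ≡⟨ cong (λ x → A (suc r) xor A m xor A x) m∸r≡1+r ⟩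
    A (suc r) xor A m xor A (suc r)     ≡⟨ cancel-outer (A (suc r)) (A m) ⟩
    A m                                 ∎
    where
    open ≡-Reasoning
    m∸r≡1+r : m ∸ r ≡ suc r
    m∸r≡1+r = trans (cong (_∸ r) m≡2r+1) (trans (+-∸-assoc 1 (≤-double r)) (cong suc (double-∸-self r)))

module Theta (m : ℕ) (s : Seq) where

  open Interleaving m s public
  open SteinhausGraph m s public

  N : ℕ
  N = suc (double m)

  c : Seq
  c = antider (suc m) false b

  Θ : Triangle
  Θ = ∇ c

  c-step : ∀ j → c (suc (suc j)) ≡ c (suc j) xor b (suc j)
  c-step j = sym (xor-assoc (P m) (P j) (b (suc j)))

  c-palindrome : ∀ j → 1 ≤ j → j ≤ N → c (N ∸ j + 1) ≡ c j
  c-palindrome (suc j) _ (s≤s j≤2m) =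
    cong (P m xor_) (trans (cong P (m+n∸n≡m (double m ∸ j) 1)) (P-palindrome j j≤2m))

  Θ-row₂ : ∀ j → Θ 2 (suc (suc j)) ≡ b (suc j)
  Θ-row₂ j = trans (cong (c (suc j) xor_) (c-step j)) (cancel (c (suc j)) (b (suc j)))
    where
    cancel : ∀ x y → x xor (x xor y) ≡ y
    cancel = solve-∀ xorRing

  Θ-even-columns : TriEq m (λ k l → Θ (double k) (double l)) T
  Θ-even-columns k l 1≤k k≤l l≤m =
    trans (∇-even-rows c double (λ _ → refl) m k l 1≤k k≤l l≤m) (∇-cong m row₂ k l 1≤k k≤l l≤m)
    where
    row₂ : ∀ l → 1 ≤ l → l ≤ m → Θ 2 (double l) ≡ s l
    row₂ (suc l) _ _ = trans (Θ-row₂ (double l)) (ir-odd m s l)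

  Θ-odd-columns : TriEq m (λ k l → Θ (double k) (suc (double l))) (hrefl m T)
  Θ-odd-columns k l 1≤k k≤l l≤m =
    trans (∇-even-rows c (λ l → suc (double l)) (λ _ → refl) m k l 1≤k k≤l l≤m)
          (trans (∇-cong m row₂ k l 1≤k k≤l l≤m) (sym (hrefl-∇ s m k l 1≤k k≤l l≤m)))
    where
    row₂ : ∀ l → 1 ≤ l → l ≤ m → Θ 2 (suc (double l)) ≡ s (m ∸ l + 1)
    row₂ (suc l) _ _ = trans (Θ-row₂ (suc (double l))) (ir-even m s l)

  edge-even : ∀ k → 1 ≤ k → k ≤ m → Θ (double k) N ≡ T k k
  edge-even k 1≤k k≤m = trans (Θ-odd-columns k m 1≤k k≤m ≤-refl) (cong (λ r → T k (r + k)) (n∸n≡0 m))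

  edge-odd : ∀ k → 1 ≤ k → k ≤ m → Θ (suc (double k)) N ≡ T k m xor T k k
  edge-odd (suc k) 1≤k k≤m = cong₂ _xor_ (Θ-even-columns (suc k) m 1≤k k≤m ≤-refl) (edge-even (suc k) 1≤k k≤m)

  edgeDefect : Seq
  edgeDefect i = Θ i N xor c i

  edgeDefect-first : edgeDefect 1 ≡ false
  edgeDefect-first = ≡⇒xor≡false (trans (cong c (sym (+-comm (double m) 1))) (c-palindrome 1 ≤-refl (s≤s z≤n)))

  edgeDefect-even-step : ∀ k → k < m → edgeDefect (double (suc k)) ≡ edgeDefect (suc (double k)) xor deg (suc k)
  edgeDefect-even-step zero 0<m = begin
    Θ 2 N xor c 2          ≡⟨ cong₂ _xor_ (edge-even 1 ≤-refl 0<m) (trans (c-step 0) (cong (c 1 xor_) (ir-odd m s 0))) ⟩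
    s 1 xor (c 1 xor s 1)  ≡⟨ cancel (s 1) (c 1) ⟩
    P m xor false          ≡⟨ xor-identityʳ (P m) ⟩
    P m                    ≡⟨ P-half ⟩
    A m                    ≡⟨ sym deg-first ⟩
    deg 1                  ≡⟨ cong (_xor deg 1) (sym edgeDefect-first) ⟩
    edgeDefect 1 xor deg 1 ∎
    where
    open ≡-Reasoning
    cancel : ∀ x y → x xor (y xor x) ≡ y
    cancel = solve-∀ xorRing
  edgeDefect-even-step (suc k) 1+k<m = begin
    Θ (double (suc (suc k))) N xor c (double (suc (suc k)))
      ≡⟨ cong₂ _xor_ (edge-even (suc (suc k)) (s≤s z≤n) 1+k<m)
                     (trans (c-step (double (suc k))) (cong (c (suc (double (suc k))) xor_) (ir-odd m s (suc k)))) ⟩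
    X xor (C xor S)
      ≡⟨ rearrange X C S Y Z ⟩
    ((Y xor Z) xor C) xor ((S xor X) xor (Z xor Y))
      ≡⟨ sym (cong₂ _xor_ (cong (_xor C) (edge-odd (suc k) (s≤s z≤n) (<⇒≤ 1+k<m)))
                          (deg-inner (suc k) (s≤s z≤n) (<⇒≤ 1+k<m))) ⟩
    edgeDefect (suc (double (suc k))) xor deg (suc (suc k)) ∎
    where
    open ≡-Reasoning
    X Y Z C S : Bool
    X = T (suc (suc k)) (suc (suc k))
    Y = T (suc k) m
    Z = T (suc k) (suc k)
    C = c (suc (double (suc k)))
    S = s (suc (suc k))
    rearrange : ∀ x c s y z → x xor (c xor s) ≡ ((y xor z) xor c) xor ((s xor x) xor (z xor y))
    rearrange = solve-∀ xorRing

  edgeDefect-odd-step : ∀ k → k < m → edgeDefect (suc (double (suc k))) ≡ edgeDefect (double (suc k)) xor lastColumnDefect (suc k)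
  edgeDefect-odd-step k k<m = begin
    Θ (suc (double (suc k))) N xor c (suc (double (suc k)))
      ≡⟨ cong₂ _xor_ (edge-odd (suc k) (s≤s z≤n) k<m)
                     (trans (c-step (suc (double k))) (cong (c (double (suc k)) xor_) (ir-even m s k))) ⟩
    (T (suc k) m xor T (suc k) (suc k)) xor (c (double (suc k)) xor s (m ∸ suc k + 1))
      ≡⟨ regroup (T (suc k) m) (T (suc k) (suc k)) (c (double (suc k))) (s (m ∸ suc k + 1)) ⟩
    (T (suc k) (suc k) xor c (double (suc k))) xor (T (suc k) m xor s (m ∸ suc k + 1))
      ≡⟨ cong (λ x → (x xor c (double (suc k))) xor lastColumnDefect (suc k)) (sym (edge-even (suc k) (s≤s z≤n) k<m)) ⟩
    edgeDefect (double (suc k)) xor lastColumnDefect (suc k) ∎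
    where
    open ≡-Reasoning
    regroup : ∀ y z c r → (y xor z) xor (c xor r) ≡ (z xor c) xor (y xor r)
    regroup = solve-∀ xorRing

  defects⇔edgeDefect : (∀ k → k < m → deg (suc k) ≡ false × lastColumnDefect (suc k) ≡ false)
                     ⇔ (∀ i → 1 ≤ i → i ≤ N → edgeDefect i ≡ false)
  defects⇔edgeDefect =
    alternating-increments edgeDefect deg lastColumnDefect m edgeDefect-first edgeDefect-even-step edgeDefect-odd-step

  edgeDefect⇔edge : (∀ i → 1 ≤ i → i ≤ N → edgeDefect i ≡ false) ⇔ (∀ i → 1 ≤ i → i ≤ N → Θ i N ≡ c i)
  edgeDefect⇔edge = mk⇔ (λ defect≡0 i 1≤i i≤N → xor≡false⇒≡ (defect≡0 i 1≤i i≤N))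
                        (λ edge i 1≤i i≤N → ≡⇒xor≡false (edge i 1≤i i≤N))

  -- Θ is always reflection invariant, its first row being a palindrome.
  rot-invariant⇔dihedral : TriEq N (rot N Θ) Θ ⇔ DihedrallySymmetric N Θ
  rot-invariant⇔dihedral = mk⇔ (λ invariant → invariant , hrefl-invariant c N c-palindrome) proj₁

even⇔degreeParities : ∀ {m} (S : Vec Bool m) →
  IsEvenSteinhausGraph S ⇔ (∀ v → 1 ≤ v → v ≤ suc m → degreeParity (S at_) (suc m) v ≡ false)
even⇔degreeParities {m} S = mk⇔
  (λ even v 1≤v v≤n → trans (sym (oddᵇ-countAdj (S at_) v (suc m))) (Equivalence.to (2∣⇔oddᵇ≡false _) (even v 1≤v v≤n)))
  (λ even v 1≤v v≤n → Equivalence.from (2∣⇔oddᵇ≡false _) (trans (oddᵇ-countAdj (S at_) v (suc m)) (even v 1≤v v≤n)))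

size-of-θ : ∀ m → 2 * suc m ∸ 1 ≡ suc (double m)
size-of-θ m = begin
  m + suc (m + 0)   ≡⟨ +-suc m (m + 0) ⟩
  suc (m + (m + 0)) ≡⟨ cong (λ x → suc (m + x)) (+-identityʳ m) ⟩
  suc (m + m)       ≡⟨ cong suc (sym (double≡+ m)) ⟩
  suc (double m)    ∎
  where open ≡-Reasoning

mainTheorem1 : (m : ℕ) (S : Vec Bool m) →
    IsEvenSteinhausGraph S ⇔ DihedrallySymmetric (2 * suc m ∸ 1) (θ S)
mainTheorem1 m S = subst (λ K → IsEvenSteinhausGraph S ⇔ DihedrallySymmetric K (θ S)) (sym (size-of-θ m)) (begin
  IsEvenSteinhausGraph S                                                   ≈⟨ even⇔degreeParities S ⟩
  (∀ v → 1 ≤ v → v ≤ suc m → deg v ≡ false)                                ≈⟨ even⇔defects ⟩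
  (∀ k → k < m → deg (suc k) ≡ false × lastColumnDefect (suc k) ≡ false)   ≈⟨ defects⇔edgeDefect ⟩
  (∀ i → 1 ≤ i → i ≤ N → edgeDefect i ≡ false)                             ≈⟨ edgeDefect⇔edge ⟩
  (∀ i → 1 ≤ i → i ≤ N → Θ i N ≡ c i)                                      ≈⟨ edge⇔rot-invariant c N ⟩
  TriEq N (rot N Θ) Θ                                                      ≈⟨ rot-invariant⇔dihedral ⟩
  DihedrallySymmetric N Θ                                                  ∎)
  where
  open Theta m (S at_)
  open SetoidReasoning (⇔-setoid 0ℓ)
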